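{- Let $G$ be a graph and let $H$ be obtained from $G$ by subdividing an edge. If $B(G)$ is signed-graphic, then $B(H)$ is signed-graphic.
   Context: Graphs may have loops and multiple edges. The bicircular matroid $B(G)$ is the matroid on $E(G)$ whose independent sets are the edge sets spanning subgraphs with at most one cycle in each component. A signed graph is a graph with each edge labelled $+1$ or $-1$; a circle is positive if the product of its edge signs is $1$, negative otherwise. Its frame matroid is the matroid on the edge set whose independent sets are those spanning subgraphs with no positive circle and at most one negative circle in each component. A matroid is signed-graphic if it is isomorphic to the frame matroid of some signed graph. Subdividing an edge means replacing it by a path of length two through a new vertex. -}

module Defs where

open import Data.Nat using (ℕ; zero; suc; _+_)
open import Data.Fin using (Fin; zero; suc; _≟_)
open import Data.Bool using (Bool; true; false; if_then_else_)
import Data.Product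
open import Data.Product using (_×_; _,_; proj₁; proj₂; ∃; ∃-syntax)
open import Data.Unit using (⊤)
open import Data.Sum using (_⊎_)
open import Data.Sign using (Sign) renaming (_*_ to _·_)
open import Relation.Nullary using (¬_; yes; no)
open import Relation.Binary.PropositionalEquality using (_≡_; _≢_)
open import Function.Bundles using (_↔_; Inverse)

-- A finite graph, loops and parallel edges allowed.
-- Each edge has an (unordered) pair of ends, recorded as an ordered pair;
-- a loop has both ends equal.
record Graph : Set where
  field
    nV   : ℕ
    nE   : ℕ
    ends : Fin nE → Fin nV × Fin nV
open Graph public

ESet : Graph → Set
ESet G = Fin (nE G) → Bool

Sub : (G : Graph) → ESet G → ESet G → Set
Sub G X Y = (e : Fin (nE G)) → X e ≡ true → Y e ≡ true

ΣFin : (n : ℕ) → (Fin n → ℕ) → ℕ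
ΣFin zero    f = 0
ΣFin (suc n) f = f zero + ΣFin n (λ i → f (suc i))

ΠSign : (n : ℕ) → (Fin n → Sign) → Sign
ΠSign zero    f = Sign.+
ΠSign (suc n) f = f zero · ΠSign n (λ i → f (suc i))

isEnd : {n : ℕ} → Fin n → Fin n → ℕ
isEnd v w with v ≟ w
... | yes _ = 1
... | no  _ = 0

-- degree of v in the spanning subgraph with edge set X (a loop counts 2)
degree : (G : Graph) → ESet G → Fin (nV G) → ℕ
degree G X v = ΣFin (nE G) λ e →
  if X e then isEnd v (proj₁ (ends G e)) + isEnd v (proj₂ (ends G e)) else 0

Joins : (G : Graph) → Fin (nE G) → Fin (nV G) → Fin (nV G) → Set
Joins G e u w = ends G e ≡ (u , w) ⊎ ends G e ≡ (w , u)

data Conn (G : Graph) (X : ESet G) : Fin (nV G) → Fin (nV G) → Set where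
  here : ∀ {u} → Conn G X u u
  step : ∀ {u w v} (e : Fin (nE G)) → X e ≡ true → Joins G e u w →
         Conn G X w v → Conn G X u v

IsCircle : (G : Graph) → ESet G → Set
IsCircle G C =
  (∃[ e ] C e ≡ true)
  × ((v : Fin (nV G)) → degree G C v ≡ 0 ⊎ degree G C v ≡ 2)
  × ((e f : Fin (nE G)) → C e ≡ true → C f ≡ true →
       Conn G C (proj₁ (ends G e)) (proj₁ (ends G f)))

Distinct : (G : Graph) → ESet G → ESet G → Set
Distinct G C D = ∃[ e ] C e ≢ D e

TwoInComponent : (G : Graph) → (ESet G → Set) → ESet G → Set
TwoInComponent G P X =
  Data.Product.∃ λ (C : ESet G) → Data.Product.∃ λ (D : ESet G) → IsCircle G C × IsCircle G D × P C × P D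
    × Sub G C X × Sub G D X × Distinct G C D
    × (∃[ e ] ∃[ f ] C e ≡ true × D f ≡ true
         × Conn G X (proj₁ (ends G e)) (proj₁ (ends G f)))

-- Bicircular matroid B(G): X independent iff every component of (V(G),X)
-- contains at most one circle.
BicIndep : (G : Graph) → ESet G → Set
BicIndep G X = ¬ TwoInComponent G (λ (_ : ESet G) → ⊤) X

record SignedGraph : Set where
  field
    graph : Graph
    sign  : Fin (nE graph) → Sign
open SignedGraph public

circleSign : (Σ : SignedGraph) → ESet (graph Σ) → Sign
circleSign Σ C = ΠSign (nE (graph Σ)) λ e → if C e then sign Σ e else Sign.+

Positive Negative : (Σ : SignedGraph) → ESet (graph Σ) → Set
Positive Σ C = circleSign Σ C ≡ Sign.+
Negative Σ C = circleSign Σ C ≡ Sign.-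

-- Frame matroid of a signed graph: X independent iff (V,X) has no positive
-- circle and at most one negative circle in each component.
FrameIndep : (Σ : SignedGraph) → ESet (graph Σ) → Set
FrameIndep Σ X =
  ¬ (Data.Product.∃ λ (C : ESet (graph Σ)) → IsCircle (graph Σ) C × Sub (graph Σ) C X × Positive Σ C)
  × ¬ TwoInComponent (graph Σ) (Negative Σ) X

-- Matroids on Fin m given by independence predicates, and isomorphism:
-- a bijection of ground sets preserving independence both ways.
Isomorphic : {m n : ℕ} → ((Fin m → Bool) → Set) → ((Fin n → Bool) → Set) → Set
Isomorphic {m} {n} I J =
  Data.Product.∃ λ (φ : Fin m ↔ Fin n) → ((X : Fin m → Bool) →
     (I X → J (λ e → X (Inverse.from φ e))) × (J (λ e → X (Inverse.from φ e)) → I X))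

BicSignedGraphic : Graph → Set
BicSignedGraphic G =
  ∃[ Σ ] Isomorphic {nE G} {nE (graph Σ)} (BicIndep G) (FrameIndep Σ)

-- Subdivide edge e₀ of G: new vertex is zero (old vertex v becomes suc v),
-- edge e₀ = uv becomes u–new, new edge (index zero) is new–v, other edges unchanged.
subdivide : (G : Graph) → Fin (nE G) → Graph
subdivide G e₀ = record
  { nV = suc (nV G)
  ; nE = suc (nE G)
  ; ends = ends'
  }
  where
  ends' : Fin (suc (nE G)) → Fin (suc (nV G)) × Fin (suc (nV G))
  ends' zero = zero , suc (proj₂ (ends G e₀))
  ends' (suc e) with e ≟ e₀
  ... | yes _ = suc (proj₁ (ends G e)) , zero
  ... | no  _ = suc (proj₁ (ends G e)) , suc (proj₂ (ends G e))

module Submission where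

-- Let H be G with the edge e₀ = ab subdivided, so e₀ becomes two halves
-- a–z and z–b through a new vertex z.  An edge set X of H contracts to the
-- edge set π X of G keeping the old edges of X, and e₀ iff both halves lie in
-- X; an edge set D of G lifts to ι D, which takes both halves iff D has e₀.
-- As z has degree ≤ 2, a circle of H takes both halves or neither, so circles,
-- paths and "two circles in one component" correspond under π and ι; hence
-- X is independent in B(H) iff π X is independent in B(G).  With the new half
-- positive, the same holds for the frame matroids of a signed graph Σ and its
-- subdivision Σ′.  Given B(G) ≅ F(Σ) via an edge bijection φ, subdivide Σ at
-- φ(e₀): π commutes with relabelling by φ, and chaining the equivalences gives
-- B(H) ≅ F(Σ′).

open import Defs
open import Data.Nat using (ℕ; zero; suc; _+_)
open import Data.Nat.Properties using (+-comm; +-assoc; +-identityʳ; +-commutativeSemigroup)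
open import Algebra.Properties.CommutativeSemigroup +-commutativeSemigroup using (x∙yz≈y∙xz)
open import Data.Fin using (Fin; zero; suc; _≟_)
open import Data.Fin.Properties using (suc-injective)
open import Data.Fin.Permutation using (lift₀)
open import Data.Bool using (Bool; true; false; if_then_else_; _∧_)
open import Data.Product using (_×_; _,_; proj₁; proj₂; ∃-syntax)
open import Data.Sum using (_⊎_; inj₁; inj₂)
open import Data.Unit using (tt)
open import Data.Empty using (⊥-elim)
open import Data.Sign using (Sign) renaming (_*_ to _·_)
open import Relation.Nullary using (¬_; Dec; yes; no)
open import Relation.Binary.PropositionalEquality
open import Function.Bundles using (_↔_; Inverse)

module _ {G : Graph} where

  Joins-sym : ∀ {e u w} → Joins G e u w → Joins G e w u
  Joins-sym (inj₁ p) = inj₂ p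
  Joins-sym (inj₂ p) = inj₁ p

  Conn-trans : ∀ {X u v w} → Conn G X u v → Conn G X v w → Conn G X u w
  Conn-trans here           q = q
  Conn-trans (step e x j p) q = step e x j (Conn-trans p q)

  Conn-sym : ∀ {X u v} → Conn G X u v → Conn G X v u
  Conn-sym here           = here
  Conn-sym (step e x j p) = Conn-trans (Conn-sym p) (step e x (Joins-sym j) here)

  Conn-mono : ∀ {X Y u v} → Sub G X Y → Conn G X u v → Conn G Y u v
  Conn-mono s here           = here
  Conn-mono s (step e x j p) = step e (s e x) j (Conn-mono s p)

  Sub-trans : ∀ {X Y Z} → Sub G X Y → Sub G Y Z → Sub G X Z
  Sub-trans s t e x = t e (s e x)

  Sub-≗ : ∀ {X Y} → (∀ e → X e ≡ Y e) → Sub G X Y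
  Sub-≗ X≗Y e x = trans (sym (X≗Y e)) x

  TwoInComponent-mono : ∀ {P X Y} → Sub G X Y → TwoInComponent G P X → TwoInComponent G P Y
  TwoInComponent-mono s (C , D , cC , cD , pC , pD , sC , sD , dist , e , f , ce , df , conn) =
    C , D , cC , cD , pC , pD , Sub-trans sC s , Sub-trans sD s , dist ,
    e , f , ce , df , Conn-mono s conn

FrameIndep-hereditary : ∀ {S X Y} → Sub (graph S) Y X → FrameIndep S X → FrameIndep S Y
FrameIndep-hereditary {S} s (noPositive , noTwoNegative) =
  (λ { (C , cC , sC , pos) → noPositive (C , cC , Sub-trans {graph S} sC s , pos) }) ,
  (λ two → noTwoNegative (TwoInComponent-mono s two))

ΣFin-ext : ∀ n (f g : Fin n → ℕ) → (∀ i → f i ≡ g i) → ΣFin n f ≡ ΣFin n g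
ΣFin-ext zero    f g f≗g = refl
ΣFin-ext (suc n) f g f≗g = cong₂ _+_ (f≗g zero) (ΣFin-ext n _ _ (λ i → f≗g (suc i)))

ΣFin-zero : ∀ n → ΣFin n (λ _ → 0) ≡ 0
ΣFin-zero zero    = refl
ΣFin-zero (suc n) = ΣFin-zero n

ΣFin-update : ∀ n (i₀ : Fin n) (f g : Fin n → ℕ) c →
  (∀ i → ¬ i ≡ i₀ → g i ≡ f i) → g i₀ ≡ c + f i₀ → ΣFin n g ≡ c + ΣFin n f
ΣFin-update (suc n) zero f g c agree raised = begin
  g zero + ΣFin n (λ i → g (suc i))   ≡⟨ cong₂ _+_ raised (ΣFin-ext n _ _ (λ i → agree (suc i) λ ())) ⟩
  c + f zero + ΣFin n (λ i → f (suc i)) ≡⟨ +-assoc c _ _ ⟩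
  c + (f zero + ΣFin n (λ i → f (suc i))) ∎
  where open ≡-Reasoning
ΣFin-update (suc n) (suc i₀) f g c agree raised = begin
  g zero + ΣFin n (λ i → g (suc i))     ≡⟨ cong₂ _+_ (agree zero λ ()) (ΣFin-update n i₀ _ _ c agree′ raised) ⟩
  f zero + (c + ΣFin n (λ i → f (suc i))) ≡⟨ x∙yz≈y∙xz (f zero) c _ ⟩
  c + (f zero + ΣFin n (λ i → f (suc i))) ∎
  where
  open ≡-Reasoning
  agree′ : ∀ i → ¬ i ≡ i₀ → g (suc i) ≡ f (suc i)
  agree′ i i≢i₀ = agree (suc i) (λ eq → i≢i₀ (suc-injective eq))

ΠSign-ext : ∀ n (f g : Fin n → Sign) → (∀ i → f i ≡ g i) → ΠSign n f ≡ ΠSign n g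
ΠSign-ext zero    f g f≗g = refl
ΠSign-ext (suc n) f g f≗g = cong₂ _·_ (f≗g zero) (ΠSign-ext n _ _ (λ i → f≗g (suc i)))

weight : Bool → ℕ → ℕ
weight b n = if b then n else 0

weight-zero : ∀ b → weight b 0 ≡ 0
weight-zero true  = refl
weight-zero false = refl

weight-+ : ∀ b m n → weight b (m + n) ≡ weight b m + weight b n
weight-+ true  m n = refl
weight-+ false m n = refl

weights-even⇒equal : ∀ x y → weight x 1 + weight y 1 ≡ 0 ⊎ weight x 1 + weight y 1 ≡ 2 → x ≡ y
weights-even⇒equal true  true  _        = refl
weights-even⇒equal false false _        = refl
weights-even⇒equal true  false (inj₁ ())
weights-even⇒equal true  false (inj₂ ())
weights-even⇒equal false true  (inj₁ ())
weights-even⇒equal false true  (inj₂ ())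

weight-double : ∀ x → weight x 1 + weight x 1 ≡ 0 ⊎ weight x 1 + weight x 1 ≡ 2
weight-double true  = inj₂ refl
weight-double false = inj₁ refl

endCount : {n : ℕ} → Fin n → Fin n × Fin n → ℕ
endCount v p = isEnd v (proj₁ p) + isEnd v (proj₂ p)

incidence : (G : Graph) → ESet G → Fin (nV G) → Fin (nE G) → ℕ
incidence G X v e = weight (X e) (endCount v (ends G e))

isEnd-suc : ∀ {n} (v w : Fin n) → isEnd {suc n} (suc v) (suc w) ≡ isEnd v w
isEnd-suc v w with v ≟ w
... | yes _ = refl
... | no  _ = refl

endCount-suc : ∀ {n} (v : Fin n) p → endCount {suc n} (suc v) (suc (proj₁ p) , suc (proj₂ p)) ≡ endCount v p
endCount-suc v (p , q) = cong₂ _+_ (isEnd-suc v p) (isEnd-suc v q)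

∧-true-left : ∀ {x y} → x ∧ y ≡ true → x ≡ true
∧-true-left {true} _ = refl

∧-true-right : ∀ x {y} → x ∧ y ≡ true → y ≡ true
∧-true-right true xy = xy

module Subdivision (G : Graph) (e₀ : Fin (nE G)) where

  H : Graph
  H = subdivide G e₀

  a b : Fin (nV G)
  a = proj₁ (ends G e₀)
  b = proj₂ (ends G e₀)

  ends-other : ∀ e → ¬ e ≡ e₀ → ends H (suc e) ≡ (suc (proj₁ (ends G e)) , suc (proj₂ (ends G e)))
  ends-other e e≢e₀ with e ≟ e₀
  ... | yes e≡e₀ = ⊥-elim (e≢e₀ e≡e₀)
  ... | no  _    = refl

  ends-e₀ : ends H (suc e₀) ≡ (suc a , zero)
  ends-e₀ with e₀ ≟ e₀
  ... | yes _   = refl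
  ... | no  e₀≢ = ⊥-elim (e₀≢ refl)

  first-end : ∀ e → proj₁ (ends H (suc e)) ≡ suc (proj₁ (ends G e))
  first-end e with e ≟ e₀
  ... | yes refl = refl
  ... | no  _    = refl

  π : ESet H → ESet G
  π X e with e ≟ e₀
  ... | yes _ = X (suc e) ∧ X zero
  ... | no  _ = X (suc e)

  ι : ESet G → ESet H
  ι D zero    = D e₀
  ι D (suc e) = D e

  -- X takes both halves of e₀ or neither (true of every circle of H).
  Uniform : ESet H → Set
  Uniform X = X zero ≡ X (suc e₀)

  π-other : ∀ X e → ¬ e ≡ e₀ → π X e ≡ X (suc e)
  π-other X e e≢e₀ with e ≟ e₀
  ... | yes e≡e₀ = ⊥-elim (e≢e₀ e≡e₀)
  ... | no  _    = refl

  π-e₀ : ∀ X → π X e₀ ≡ X (suc e₀) ∧ X zero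
  π-e₀ X with e₀ ≟ e₀
  ... | yes _   = refl
  ... | no  e₀≢ = ⊥-elim (e₀≢ refl)

  π-uniform : ∀ X → Uniform X → ∀ e → π X e ≡ X (suc e)
  π-uniform X u e with e ≟ e₀
  ... | no  _    = refl
  ... | yes refl with X zero | X (suc e₀)
  ...   | true  | true  = refl
  ...   | false | false = refl
  ...   | true  | false = refl
  ...   | false | true  = u

  π-ι : ∀ D e → π (ι D) e ≡ D e
  π-ι D = π-uniform (ι D) refl

  π⇒old : ∀ X e → π X e ≡ true → X (suc e) ≡ true
  π⇒old X e x with e ≟ e₀
  ... | no  _    = x
  ... | yes refl = ∧-true-left x

  π⇒new : ∀ X → π X e₀ ≡ true → X zero ≡ true
  π⇒new X x = ∧-true-right (X (suc e₀)) (trans (sym (π-e₀ X)) x)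

  π-intro : ∀ X e → X (suc e) ≡ true → (e ≡ e₀ → X zero ≡ true) → π X e ≡ true
  π-intro X e x z with e ≟ e₀
  ... | no  _    = x
  ... | yes refl = cong₂ _∧_ x (z refl)

  collapse : ESet H → Fin (nV H) → Fin (nV G)
  collapse X zero    = if X zero then b else a
  collapse X (suc v) = v

  -- Crossing the half suc a–zero costs at most the edge e₀.
  collapse-half : ∀ X → X (suc e₀) ≡ true → Conn G (π X) a (collapse X zero)
  collapse-half X x with X zero in z
  ... | true  = step e₀ (π-intro X e₀ x (λ _ → z)) (inj₁ refl) here
  ... | false = here

  collapse-step-e₀ : ∀ {X p q} → X (suc e₀) ≡ true → Joins H (suc e₀) p q →
    Conn G (π X) (collapse X p) (collapse X q)
  collapse-step-e₀ {X} x (inj₁ j) with trans (sym ends-e₀) j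
  ... | refl = collapse-half X x
  collapse-step-e₀ {X} x (inj₂ j) with trans (sym ends-e₀) j
  ... | refl = Conn-sym (collapse-half X x)

  collapse-step-other : ∀ {X e p q} → ¬ e ≡ e₀ → X (suc e) ≡ true → Joins H (suc e) p q →
    Conn G (π X) (collapse X p) (collapse X q)
  collapse-step-other {X} {e} e≢e₀ x (inj₁ j) with trans (sym (ends-other e e≢e₀)) j
  ... | refl = step e (π-intro X e x (λ e≡e₀ → ⊥-elim (e≢e₀ e≡e₀))) (inj₁ refl) here
  collapse-step-other {X} {e} e≢e₀ x (inj₂ j) with trans (sym (ends-other e e≢e₀)) j
  ... | refl = step e (π-intro X e x (λ e≡e₀ → ⊥-elim (e≢e₀ e≡e₀))) (inj₂ refl) here

  collapse-step : ∀ {X g p q} → X g ≡ true → Joins H g p q → Conn G (π X) (collapse X p) (collapse X q)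
  collapse-step {X} {zero} x (inj₁ refl) rewrite x = here
  collapse-step {X} {zero} x (inj₂ refl) rewrite x = here
  collapse-step {X} {suc e} = byCase (e ≟ e₀)
    where
    byCase : ∀ {p q} → Dec (e ≡ e₀) → X (suc e) ≡ true → Joins H (suc e) p q →
      Conn G (π X) (collapse X p) (collapse X q)
    byCase (yes refl)  = collapse-step-e₀
    byCase (no  e≢e₀) = collapse-step-other e≢e₀

  Conn-contract : ∀ {X p q} → Conn H X p q → Conn G (π X) (collapse X p) (collapse X q)
  Conn-contract here           = here
  Conn-contract (step g x j r) = Conn-trans (collapse-step x j) (Conn-contract r)

  lift-step-e₀ : ∀ {X u w} → π X e₀ ≡ true → Joins G e₀ u w → Conn H X (suc u) (suc w)
  lift-step-e₀ {X} x (inj₁ refl) =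
    step (suc e₀) (π⇒old X e₀ x) (inj₁ ends-e₀) (step zero (π⇒new X x) (inj₁ refl) here)
  lift-step-e₀ {X} x (inj₂ refl) =
    step zero (π⇒new X x) (inj₂ refl) (step (suc e₀) (π⇒old X e₀ x) (inj₂ ends-e₀) here)

  lift-step-other : ∀ {X e u w} → ¬ e ≡ e₀ → π X e ≡ true → Joins G e u w → Conn H X (suc u) (suc w)
  lift-step-other {X} {e} e≢e₀ x (inj₁ refl) = step (suc e) (π⇒old X e x) (inj₁ (ends-other e e≢e₀)) here
  lift-step-other {X} {e} e≢e₀ x (inj₂ refl) = step (suc e) (π⇒old X e x) (inj₂ (ends-other e e≢e₀)) here

  lift-step : ∀ {X e u w} → π X e ≡ true → Joins G e u w → Conn H X (suc u) (suc w)
  lift-step {X} {e} = byCase (e ≟ e₀)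
    where
    byCase : ∀ {u w} → Dec (e ≡ e₀) → π X e ≡ true → Joins G e u w → Conn H X (suc u) (suc w)
    byCase (yes refl)  = lift-step-e₀
    byCase (no  e≢e₀) = lift-step-other e≢e₀

  Conn-lift : ∀ {X u w} → Conn G (π X) u w → Conn H X (suc u) (suc w)
  Conn-lift here           = here
  Conn-lift (step e x j r) = Conn-trans (lift-step x j) (Conn-lift r)

  degree-new : ∀ C → degree H C zero ≡ weight (C zero) 1 + weight (C (suc e₀)) 1
  degree-new C = cong (weight (C zero) 1 +_) (begin
    ΣFin (nE G) (λ e → incidence H C zero (suc e))  ≡⟨ ΣFin-update (nE G) e₀ (λ _ → 0) _ _ away atHalf ⟩
    weight (C (suc e₀)) 1 + ΣFin (nE G) (λ _ → 0)   ≡⟨ cong (weight (C (suc e₀)) 1 +_) (ΣFin-zero (nE G)) ⟩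
    weight (C (suc e₀)) 1 + 0                       ≡⟨ +-identityʳ _ ⟩
    weight (C (suc e₀)) 1                           ∎)
    where
    open ≡-Reasoning
    away : ∀ e → ¬ e ≡ e₀ → incidence H C zero (suc e) ≡ 0
    away e e≢e₀ = trans (cong (λ p → weight (C (suc e)) (endCount zero p)) (ends-other e e≢e₀))
                        (weight-zero (C (suc e)))
    atHalf : incidence H C zero (suc e₀) ≡ weight (C (suc e₀)) 1 + 0
    atHalf = trans (cong (λ p → weight (C (suc e₀)) (endCount zero p)) ends-e₀) (sym (+-identityʳ _))

  -- For a uniform edge set, old vertices keep their degree: the two halves
  -- together contribute what e₀ contributes after contraction.
  degree-old : ∀ C → Uniform C → ∀ v → degree H C (suc v) ≡ degree G (π C) v
  degree-old C u v = sym (ΣFin-update (nE G) e₀ (λ e → incidence H C (suc v) (suc e)) (incidence G (π C) v) _ away atE₀)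
    where
    open ≡-Reasoning
    x : Bool
    x = C (suc e₀)
    away : ∀ e → ¬ e ≡ e₀ → incidence G (π C) v e ≡ incidence H C (suc v) (suc e)
    away e e≢e₀ = cong₂ weight (π-other C e e≢e₀)
      (trans (sym (endCount-suc v (ends G e))) (cong (endCount (suc v)) (sym (ends-other e e≢e₀))))
    halfCount : endCount (suc v) (ends H (suc e₀)) ≡ isEnd v a
    halfCount = trans (cong (endCount (suc v)) ends-e₀) (trans (+-identityʳ _) (isEnd-suc v a))
    atE₀ : incidence G (π C) v e₀ ≡ incidence H C (suc v) zero + incidence H C (suc v) (suc e₀)
    atE₀ = begin
      weight (π C e₀) (isEnd v a + isEnd v b)            ≡⟨ cong (λ y → weight y (isEnd v a + isEnd v b)) (π-uniform C u e₀) ⟩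
      weight x (isEnd v a + isEnd v b)                   ≡⟨ weight-+ x _ _ ⟩
      weight x (isEnd v a) + weight x (isEnd v b)        ≡⟨ +-comm (weight x (isEnd v a)) _ ⟩
      weight x (isEnd v b) + weight x (isEnd v a)        ≡⟨ cong₂ _+_ (cong₂ weight (sym u) (sym (isEnd-suc v b)))
                                                              (cong (weight x) (sym halfCount)) ⟩
      incidence H C (suc v) zero + incidence H C (suc v) (suc e₀) ∎

  -- The new vertex has degree 0 or 2 on a circle, so a circle is uniform.
  circle-uniform : ∀ {C} → IsCircle H C → Uniform C
  circle-uniform {C} (_ , deg , _) =
    weights-even⇒equal (C zero) (C (suc e₀)) (subst (λ n → n ≡ 0 ⊎ n ≡ 2) (degree-new C) (deg zero))

  circle-contract : ∀ {C} → IsCircle H C → IsCircle G (π C)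
  circle-contract {C} cC@(nonempty , deg , conn) = nonempty′ nonempty , deg′ , conn′
    where
    u : Uniform C
    u = circle-uniform cC
    nonempty′ : ∃[ g ] C g ≡ true → ∃[ e ] π C e ≡ true
    nonempty′ (zero  , c) = e₀ , π-intro C e₀ (trans (sym u) c) (λ _ → c)
    nonempty′ (suc e , c) = e , trans (π-uniform C u e) c
    deg′ : ∀ v → degree G (π C) v ≡ 0 ⊎ degree G (π C) v ≡ 2
    deg′ v = subst (λ n → n ≡ 0 ⊎ n ≡ 2) (degree-old C u v) (deg (suc v))
    conn′ : ∀ e f → π C e ≡ true → π C f ≡ true → Conn G (π C) (proj₁ (ends G e)) (proj₁ (ends G f))
    conn′ e f ce cf = Conn-contract (subst₂ (Conn H C) (first-end e) (first-end f)
      (conn (suc e) (suc f) (π⇒old C e ce) (π⇒old C f cf)))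

  lift-anchor : ∀ {D} g → ι D g ≡ true → ∃[ e ] (D e ≡ true × Conn H (ι D) (proj₁ (ends H g)) (suc (proj₁ (ends G e))))
  lift-anchor zero    d = e₀ , d , step (suc e₀) d (inj₂ ends-e₀) here
  lift-anchor (suc e) d = e , d , subst (λ w → Conn H _ w (suc (proj₁ (ends G e)))) (sym (first-end e)) here

  circle-lift : ∀ {D} → IsCircle G D → IsCircle H (ι D)
  circle-lift {D} ((e , d) , deg , conn) = (suc e , d) , deg′ , conn′
    where
    deg′ : ∀ w → degree H (ι D) w ≡ 0 ⊎ degree H (ι D) w ≡ 2
    deg′ zero    = subst (λ n → n ≡ 0 ⊎ n ≡ 2) (sym (degree-new (ι D))) (weight-double (D e₀))
    deg′ (suc v) = subst (λ n → n ≡ 0 ⊎ n ≡ 2)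
      (sym (trans (degree-old (ι D) refl v) (ΣFin-ext (nE G) _ _ (λ e → cong (λ y → weight y _) (π-ι D e))))) (deg v)
    conn′ : ∀ g h → ι D g ≡ true → ι D h ≡ true → Conn H (ι D) (proj₁ (ends H g)) (proj₁ (ends H h))
    conn′ g h dg dh with lift-anchor {D} g dg | lift-anchor {D} h dh
    ... | e , de , A | f , df , B =
      Conn-trans A (Conn-trans (Conn-lift (Conn-mono (Sub-≗ {G} (λ e → sym (π-ι D e))) (conn e f de df))) (Conn-sym B))

  Sub-contract : ∀ {C X} → Sub H C X → Uniform C → Sub G (π C) (π X)
  Sub-contract {C} {X} s u e c = π-intro X e (s (suc e) (π⇒old C e c))
    (λ { refl → s zero (trans u (π⇒old C e₀ c)) })

  Sub-lift : ∀ {D X} → Sub G D (π X) → Sub H (ι D) X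
  Sub-lift {X = X} s zero    d = π⇒new X (s e₀ d)
  Sub-lift {X = X} s (suc e) d = π⇒old X e (s e d)

  Distinct-contract : ∀ {C D} → Uniform C → Uniform D → Distinct H C D → Distinct G (π C) (π D)
  Distinct-contract {C} {D} uC uD (zero , C≢D) =
    e₀ , λ eq → C≢D (trans uC (trans (sym (π-uniform C uC e₀)) (trans eq (trans (π-uniform D uD e₀) (sym uD)))))
  Distinct-contract {C} {D} uC uD (suc e , C≢D) =
    e , λ eq → C≢D (trans (sym (π-uniform C uC e)) (trans eq (π-uniform D uD e)))

  contract-anchor : ∀ {C X} g → Uniform C → Sub H C X → C g ≡ true →
    ∃[ e ] (π C e ≡ true × Conn G (π X) (proj₁ (ends G e)) (collapse X (proj₁ (ends H g))))
  contract-anchor {C} {X} zero u s c rewrite s zero c =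
    e₀ , π-intro C e₀ (trans (sym u) c) (λ _ → c) ,
    step e₀ (π-intro X e₀ (s (suc e₀) (trans (sym u) c)) (λ _ → s zero c)) (inj₁ refl) here
  contract-anchor {C} {X} (suc e) u s c =
    e , trans (π-uniform C u e) c , subst (λ w → Conn G (π X) (proj₁ (ends G e)) (collapse X w)) (sym (first-end e)) here

  TwoInComponent-contract : ∀ {P : ESet H → Set} {Q : ESet G → Set} {X} →
    (∀ C → IsCircle H C → P C → Q (π C)) → TwoInComponent H P X → TwoInComponent G Q (π X)
  TwoInComponent-contract {X = X} P⇒Q (C , D , cC , cD , pC , pD , sC , sD , dist , g , h , cg , dh , conn)
    with contract-anchor g (circle-uniform cC) sC cg | contract-anchor h (circle-uniform cD) sD dh
  ... | e , ce , A | f , df , B =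
    π C , π D , circle-contract cC , circle-contract cD , P⇒Q C cC pC , P⇒Q D cD pD ,
    Sub-contract sC (circle-uniform cC) , Sub-contract sD (circle-uniform cD) ,
    Distinct-contract (circle-uniform cC) (circle-uniform cD) dist ,
    e , f , ce , df , Conn-trans A (Conn-trans (Conn-contract conn) (Conn-sym B))

  TwoInComponent-lift : ∀ {P : ESet H → Set} {Q : ESet G → Set} {X} →
    (∀ D → IsCircle G D → Q D → P (ι D)) → TwoInComponent G Q (π X) → TwoInComponent H P X
  TwoInComponent-lift {X = X} Q⇒P (D , D′ , cD , cD′ , q , q′ , sD , sD′ , (e′ , D≢D′) , e , f , de , df , conn) =
    ι D , ι D′ , circle-lift cD , circle-lift cD′ , Q⇒P D cD q , Q⇒P D′ cD′ q′ ,
    Sub-lift sD , Sub-lift sD′ , (suc e′ , D≢D′) ,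
    suc e , suc f , de , df , subst₂ (Conn H X) (sym (first-end e)) (sym (first-end f)) (Conn-lift conn)

  BicIndep-contract : ∀ X → BicIndep H X → BicIndep G (π X)
  BicIndep-contract X indep two = indep (TwoInComponent-lift (λ _ _ _ → tt) two)

  BicIndep-uncontract : ∀ X → BicIndep G (π X) → BicIndep H X
  BicIndep-uncontract X indep two = indep (TwoInComponent-contract (λ _ _ _ → tt) two)

module SignedSubdivision (S : SignedGraph) (e₀ : Fin (nE (graph S))) where
  open Subdivision (graph S) e₀

  subdivisionSign : Fin (nE H) → Sign
  subdivisionSign zero    = Sign.+
  subdivisionSign (suc e) = sign S e

  S′ : SignedGraph
  S′ = record { graph = H ; sign = subdivisionSign }

  positive-head : ∀ (x : Bool) s → (if x then Sign.+ else Sign.+) · s ≡ s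
  positive-head true  s = refl
  positive-head false s = refl

  sign-contract : ∀ C → Uniform C → circleSign S′ C ≡ circleSign S (π C)
  sign-contract C u = trans (positive-head (C zero) _) (ΠSign-ext (nE (graph S)) _ _
    (λ e → cong (λ x → if x then sign S e else Sign.+) (sym (π-uniform C u e))))

  sign-lift : ∀ D → circleSign S′ (ι D) ≡ circleSign S D
  sign-lift D = positive-head (D e₀) _

  FrameIndep-contract : ∀ X → FrameIndep S′ X → FrameIndep S (π X)
  FrameIndep-contract X (noPositive , noTwoNegative) =
    (λ { (D , cD , sD , pos) → noPositive (ι D , circle-lift cD , Sub-lift sD , trans (sign-lift D) pos) }) ,
    (λ two → noTwoNegative (TwoInComponent-lift (λ D _ neg → trans (sign-lift D) neg) two))

  FrameIndep-uncontract : ∀ X → FrameIndep S (π X) → FrameIndep S′ X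
  FrameIndep-uncontract X (noPositive , noTwoNegative) =
    (λ { (C , cC , sC , pos) → noPositive (π C , circle-contract cC , Sub-contract sC (circle-uniform cC) ,
                                           trans (sym (sign-contract C (circle-uniform cC))) pos) }) ,
    (λ two → noTwoNegative (TwoInComponent-contract
               (λ C cC neg → trans (sym (sign-contract C (circle-uniform cC))) neg) two))

-- Contraction commutes with relabelling edges along a bijection φ of edge sets,
-- extended to the subdivisions by fixing the new half-edge zero.
module Relabelling (G K : Graph) (φ : Fin (nE G) ↔ Fin (nE K)) (e₀ : Fin (nE G)) where
  open Inverse φ
  private
    module G = Subdivision G e₀
    module K = Subdivision K (to e₀)

  relabel : ESet G.H → ESet K.H
  relabel X e = X (Inverse.from (lift₀ φ) e)

  π-relabel : ∀ X e → K.π (relabel X) e ≡ G.π X (from e)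
  π-relabel X e = byCase (e ≟ to e₀)
    where
    open ≡-Reasoning
    byCase : Dec (e ≡ to e₀) → K.π (relabel X) e ≡ G.π X (from e)
    byCase (yes refl) = begin
      K.π (relabel X) (to e₀)          ≡⟨ K.π-e₀ (relabel X) ⟩
      X (suc (from (to e₀))) ∧ X zero  ≡⟨ cong (λ d → X (suc d) ∧ X zero) (strictlyInverseʳ e₀) ⟩
      X (suc e₀) ∧ X zero              ≡⟨ sym (G.π-e₀ X) ⟩
      G.π X e₀                         ≡⟨ cong (G.π X) (sym (strictlyInverseʳ e₀)) ⟩
      G.π X (from (to e₀))             ∎
    byCase (no e≢) = trans (K.π-other (relabel X) e e≢)
      (sym (G.π-other X (from e) (λ eq → e≢ (trans (sym (strictlyInverseˡ e)) (cong to eq)))))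

lemma6 : (G : Graph) (e : Fin (nE G)) →
    BicSignedGraphic G → BicSignedGraphic (subdivide G e)
lemma6 G e₀ (S , φ , B≅F) = S′ , lift₀ φ , λ X → forward X , backward X
  where
  open Subdivision G e₀ using (π; BicIndep-contract; BicIndep-uncontract)
  open SignedSubdivision S (Inverse.to φ e₀) using (S′; FrameIndep-contract; FrameIndep-uncontract)
  open Relabelling G (graph S) φ e₀ using (relabel; π-relabel)

  -- B(H) ∋ X  ⇒  B(G) ∋ π X  ⇒  F(Σ) ∋ π X ∘ φ⁻¹ = π (relabel X)  ⇒  F(Σ′) ∋ relabel X
  forward : ∀ X → BicIndep (subdivide G e₀) X → FrameIndep S′ (relabel X)
  forward X indep = FrameIndep-uncontract (relabel X)
    (FrameIndep-hereditary {S} (Sub-≗ {graph S} (π-relabel X))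
      (proj₁ (B≅F (π X)) (BicIndep-contract X indep)))

  backward : ∀ X → FrameIndep S′ (relabel X) → BicIndep (subdivide G e₀) X
  backward X indep = BicIndep-uncontract X
    (proj₂ (B≅F (π X))
      (FrameIndep-hereditary {S} (Sub-≗ {graph S} (λ e → sym (π-relabel X e)))
        (FrameIndep-contract (relabel X) indep)))
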